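{- Let $n \geq 2$ be an integer with distinct prime divisors $p_1, \dots, p_r$, and let $X_n$ be the unitary Cayley graph on $\mathbb{Z}_n$. Let $C$ be an induced cycle in $X_n$ of length $k > 4$. Then there do not exist two distinct vertices $x, y$ of $C$ with $x \equiv y \pmod{p_i}$ for all $1 \leq i \leq r$ (i.e. no two distinct vertices of $C$ have the same residue representation).
   Context: For a positive integer $n$, the unitary Cayley graph $X_n = \mathrm{Cay}(\mathbb{Z}_n, U_n)$ has vertex set $\mathbb{Z}_n$, and $x,y$ are adjacent iff $x - y \in U_n$, the group of units of $\mathbb{Z}_n$. An induced cycle of length $k \geq 3$ is a sequence of $k$ distinct vertices $v_0, \dots, v_{k-1}$ such that $v_i$ and $v_j$ are adjacent if and only if $i - j \equiv \pm 1 \pmod k$. The residue representation of $x \in \mathbb{Z}_n$ is the string $\alpha_1\alpha_2\cdots\alpha_r$ with $0 \le \alpha_i < p_i$ and $x \equiv \alpha_i \pmod{p_i}$. -}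

module Defs where

open import Data.Nat using (ℕ; zero; suc; _+_; _∸_; _%_; NonZero; _≤_; _<_)
open import Data.Nat.Coprimality using (Coprime)
open import Data.Nat.Divisibility using (_∣_)
open import Data.Nat.Primality using (Prime)
open import Data.Fin using (Fin; toℕ)
open import Data.Product using (_×_; Σ)
open import Data.Sum using (_⊎_)
open import Function.Definitions using (Injective)
open import Relation.Binary.PropositionalEquality using (_≡_)

diffMod : (n : ℕ) .{{_ : NonZero n}} → Fin n → Fin n → ℕ
diffMod n x y = (toℕ x + (n ∸ toℕ y)) % n

-- x, y adjacent in the unitary Cayley graph X_n = Cay(ℤ_n, U_n):
-- x - y is a unit of ℤ_n, i.e. coprime to n
Adj : (n : ℕ) .{{_ : NonZero n}} → Fin n → Fin n → Set
Adj n x y = Coprime (diffMod n x y) n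

CycAdj : (k : ℕ) .{{_ : NonZero k}} → Fin k → Fin k → Set
CycAdj k i j = ((toℕ i + 1) % k ≡ toℕ j) ⊎ ((toℕ j + 1) % k ≡ toℕ i)

record InducedCycle (n : ℕ) .{{_ : NonZero n}} (k : ℕ) .{{_ : NonZero k}} : Set where
  field
    vert      : Fin k → Fin n
    distinct  : Injective _≡_ _≡_ vert
    adj⇔cyc   : ∀ i j → (Adj n (vert i) (vert j) → CycAdj k i j)
                      × (CycAdj k i j → Adj n (vert i) (vert j))

SameResidueRep : (n : ℕ) → Fin n → Fin n → Set
SameResidueRep n x y = ∀ (p : ℕ) .{{_ : NonZero p}} → Prime p → p ∣ n → toℕ x % p ≡ toℕ y % p

module Submission where

-- Two vertices with the same residue representation differ from any third vertex z by
-- numbers divisible by exactly the same primes p ∣ n, so they have the same neighbours.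
-- If v_i ≠ v_j share it, then v_j is adjacent to v_{i+1}; as the cycle is induced and
-- j ≠ i, this forces j = i + 2. Symmetrically i = j + 2, so k ∣ 4, impossible for k > 4.

open import Defs
open import Data.Nat using (ℕ; _≤_; _<_; NonZero)
open import Data.Fin using (Fin)
open import Data.Product using (Σ; _×_)
open import Relation.Nullary using (¬_)
open import Relation.Binary.PropositionalEquality using (_≡_)

open import Data.Nat using (>-nonZero⁻¹; zero; suc; _+_; _*_; _∸_; _%_; _/_)
open import Data.Nat.Properties using (+-assoc; +-cancelˡ-≡; m+[n∸m]≡n)
open import Data.Nat.DivMod
  using (m≡m%n+[m/n]*n; m%n%n≡m%n; %-distribˡ-+; [m+n]%n≡m%n; m%n<n; m<n⇒m%n≡m; m∣n⇒o%n%m≡o%m)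
open import Data.Nat.Divisibility
  using (_∣_; divides; ∣-trans; m∣m*n; 0∣⇒≡0; m%n≡0⇒n∣m; n∣m⇒m%n≡0; >⇒∤)
open import Data.Nat.Coprimality using (Coprime)
open import Data.Nat.Primality using (Prime; ¬prime[1]; prime⇒nonZero)
open import Data.Nat.Primality.Factorisation using (factorise)
open import Data.List using ([]; _∷_)
open import Data.Nat.ListAction using (product)
open import Data.List.Relation.Unary.All using (_∷_)
open import Data.Fin using (toℕ; fromℕ<)
open import Data.Fin.Properties using (toℕ-injective; toℕ<n; toℕ-fromℕ<)
open import Data.Product using (∃-syntax; _,_; proj₁; proj₂)
open import Data.Sum using (_⊎_; inj₁; inj₂)
open import Relation.Nullary using (contradiction)
open import Relation.Binary.PropositionalEquality using (_≢_; sym; trans; cong; subst; module ≡-Reasoning)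
open import Function using (_∘_)

∣-nonZero : ∀ {d n} .{{_ : NonZero n}} → d ∣ n → NonZero d
∣-nonZero {zero} {suc _} d∣n with () ← 0∣⇒≡0 d∣n
∣-nonZero {suc _} _ = _

≡1⊎prime-divisor : ∀ d .{{_ : NonZero d}} → d ≡ 1 ⊎ ∃[ p ] Prime p × p ∣ d
≡1⊎prime-divisor d with factorise d
... | record { factors = [] ; isFactorisation = d≡Π } = inj₁ d≡Π
... | record { factors = p ∷ ps ; isFactorisation = d≡Π ; factorsPrime = p-prime ∷ _ } =
  inj₂ (p , p-prime , subst (p ∣_) (sym d≡Π) (m∣m*n (product ps)))

coprime-by-primes : ∀ {m m′ n} .{{_ : NonZero n}} →
                    (∀ {p} → Prime p → p ∣ n → p ∣ m′ → p ∣ m) →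
                    Coprime m n → Coprime m′ n
coprime-by-primes {n = n} transfer m⊥n {d} (d∣m′ , d∣n) with ≡1⊎prime-divisor d {{∣-nonZero d∣n}}
... | inj₁ d≡1 = d≡1
... | inj₂ (p , p-prime , p∣d) =
  contradiction (subst Prime (m⊥n (transfer p-prime p∣n (∣-trans p∣d d∣m′) , p∣n)) p-prime) ¬prime[1]
  where
  p∣n : p ∣ n
  p∣n = ∣-trans p∣d d∣n

diffMod-congˡ-% : ∀ n .{{_ : NonZero n}} p .{{_ : NonZero p}} → p ∣ n →
                  ∀ {x y} z → toℕ x % p ≡ toℕ y % p → diffMod n x z % p ≡ diffMod n y z % p
diffMod-congˡ-% n p p∣n {x} {y} z x≡y = begin
  (toℕ x + (n ∸ toℕ z)) % n % p           ≡⟨ m∣n⇒o%n%m≡o%m p n _ p∣n ⟩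
  (toℕ x + (n ∸ toℕ z)) % p               ≡⟨ %-distribˡ-+ (toℕ x) _ p ⟩
  (toℕ x % p + (n ∸ toℕ z) % p) % p       ≡⟨ cong (λ r → (r + (n ∸ toℕ z) % p) % p) x≡y ⟩
  (toℕ y % p + (n ∸ toℕ z) % p) % p       ≡⟨ %-distribˡ-+ (toℕ y) _ p ⟨
  (toℕ y + (n ∸ toℕ z)) % p               ≡⟨ m∣n⇒o%n%m≡o%m p n _ p∣n ⟨
  (toℕ y + (n ∸ toℕ z)) % n % p           ∎
  where open ≡-Reasoning

sameResidueRep-sym : ∀ {n x y} → SameResidueRep n x y → SameResidueRep n y x
sameResidueRep-sym x≈y p p-prime p∣n = sym (x≈y p p-prime p∣n)

sameResidueRep⇒adj : ∀ {n} .{{_ : NonZero n}} {x y} z →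
                     SameResidueRep n x y → Adj n x z → Adj n y z
sameResidueRep⇒adj {n} {x} {y} z x≈y = coprime-by-primes transfer
  where
  transfer : ∀ {p} → Prime p → p ∣ n → p ∣ diffMod n y z → p ∣ diffMod n x z
  transfer {p} p-prime p∣n p∣yz = m%n≡0⇒n∣m _ p (trans
    (diffMod-congˡ-% n p p∣n z (x≈y p p-prime p∣n))
    (n∣m⇒m%n≡0 _ p p∣yz))
    where
    instance
      p≢0 : NonZero p
      p≢0 = prime⇒nonZero p-prime

[m%n+o]%n≡[m+o]%n : ∀ m o n .{{_ : NonZero n}} → (m % n + o) % n ≡ (m + o) % n
[m%n+o]%n≡[m+o]%n m o n = begin
  (m % n + o) % n           ≡⟨ %-distribˡ-+ (m % n) o n ⟩
  (m % n % n + o % n) % n   ≡⟨ cong (λ r → (r + o % n) % n) (m%n%n≡m%n m n) ⟩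
  (m % n + o % n) % n       ≡⟨ %-distribˡ-+ m o n ⟨
  (m + o) % n               ∎
  where open ≡-Reasoning

+-cancelʳ-% : ∀ {m m′} o n .{{_ : NonZero n}} → o ≤ n →
              (m + o) % n ≡ (m′ + o) % n → m % n ≡ m′ % n
+-cancelʳ-% {m} {m′} o n o≤n m+o≡m′+o = begin
  m % n                          ≡⟨ subtract-o m ⟨
  ((m + o) % n + (n ∸ o)) % n    ≡⟨ cong (λ r → (r + (n ∸ o)) % n) m+o≡m′+o ⟩
  ((m′ + o) % n + (n ∸ o)) % n   ≡⟨ subtract-o m′ ⟩
  m′ % n                         ∎
  where
  open ≡-Reasoning
  subtract-o : ∀ l → ((l + o) % n + (n ∸ o)) % n ≡ l % n
  subtract-o l = begin
    ((l + o) % n + (n ∸ o)) % n   ≡⟨ [m%n+o]%n≡[m+o]%n (l + o) (n ∸ o) n ⟩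
    (l + o + (n ∸ o)) % n         ≡⟨ cong (_% n) (+-assoc l o (n ∸ o)) ⟩
    (l + (o + (n ∸ o))) % n       ≡⟨ cong (λ r → (l + r) % n) (m+[n∸m]≡n o≤n) ⟩
    (l + n) % n                   ≡⟨ [m+n]%n≡m%n l n ⟩
    l % n                         ∎

[m+o]%n≡m⇒n∣o : ∀ m o n .{{_ : NonZero n}} → (m + o) % n ≡ m → n ∣ o
[m+o]%n≡m⇒n∣o m o n m+o≡m = divides ((m + o) / n) (+-cancelˡ-≡ m o _ (begin
  m + o                           ≡⟨ m≡m%n+[m/n]*n (m + o) n ⟩
  (m + o) % n + (m + o) / n * n   ≡⟨ cong (_+ (m + o) / n * n) m+o≡m ⟩
  m + (m + o) / n * n             ∎))
  where open ≡-Reasoning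

module _ {k} .{{_ : NonZero k}} where

  next : Fin k → Fin k
  next i = fromℕ< (m%n<n (toℕ i + 1) k)

  toℕ-next : ∀ i → toℕ (next i) ≡ (toℕ i + 1) % k
  toℕ-next i = toℕ-fromℕ< (m%n<n (toℕ i + 1) k)

  toℕ-next-next : ∀ i → toℕ (next (next i)) ≡ (toℕ i + 2) % k
  toℕ-next-next i = begin
    toℕ (next (next i))         ≡⟨ toℕ-next (next i) ⟩
    (toℕ (next i) + 1) % k      ≡⟨ cong (λ r → (r + 1) % k) (toℕ-next i) ⟩
    ((toℕ i + 1) % k + 1) % k   ≡⟨ [m%n+o]%n≡[m+o]%n (toℕ i + 1) 1 k ⟩
    (toℕ i + 1 + 1) % k         ≡⟨ cong (_% k) (+-assoc (toℕ i) 1 1) ⟩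
    (toℕ i + 2) % k             ∎
    where open ≡-Reasoning

  next-injective : ∀ {i j} → next i ≡ next j → i ≡ j
  next-injective {i} {j} next-i≡next-j = toℕ-injective (begin
    toℕ i       ≡⟨ m<n⇒m%n≡m (toℕ<n i) ⟨
    toℕ i % k   ≡⟨ +-cancelʳ-% 1 k (>-nonZero⁻¹ k) i+1≡j+1 ⟩
    toℕ j % k   ≡⟨ m<n⇒m%n≡m (toℕ<n j) ⟩
    toℕ j       ∎)
    where
    open ≡-Reasoning
    i+1≡j+1 : (toℕ i + 1) % k ≡ (toℕ j + 1) % k
    i+1≡j+1 = trans (sym (toℕ-next i)) (trans (cong toℕ next-i≡next-j) (toℕ-next j))

  cycAdj-next : ∀ i → CycAdj k i (next i)
  cycAdj-next i = inj₁ (sym (toℕ-next i))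

  cycAdj⇒next : ∀ {i j} → CycAdj k i j → next i ≡ j ⊎ next j ≡ i
  cycAdj⇒next {i} (inj₁ i+1≡j) = inj₁ (toℕ-injective (trans (toℕ-next i) i+1≡j))
  cycAdj⇒next {j = j} (inj₂ j+1≡i) = inj₂ (toℕ-injective (trans (toℕ-next j) j+1≡i))

module _ {n} .{{_ : NonZero n}} {k} .{{_ : NonZero k}} (C : InducedCycle n k) where
  open InducedCycle C

  sameResidueRep⇒cycAdj : ∀ {i j l} → SameResidueRep n (vert i) (vert j) → CycAdj k i l → CycAdj k j l
  sameResidueRep⇒cycAdj {i} {j} {l} i≈j i~l =
    proj₁ (adj⇔cyc j l) (sameResidueRep⇒adj (vert l) i≈j (proj₂ (adj⇔cyc i l) i~l))

  sameResidueRep⇒next-next : ∀ {i j} → i ≢ j → SameResidueRep n (vert i) (vert j) → next (next i) ≡ j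
  sameResidueRep⇒next-next {i} i≢j i≈j with cycAdj⇒next (sameResidueRep⇒cycAdj i≈j (cycAdj-next i))
  ... | inj₁ next-j≡next-i = contradiction (next-injective (sym next-j≡next-i)) i≢j
  ... | inj₂ next-next-i≡j = next-next-i≡j

proposition2p4 : (n : ℕ) .{{_ : NonZero n}} → 2 ≤ n →
    (k : ℕ) .{{_ : NonZero k}} → 4 < k →
    (C : InducedCycle n k) →
    ¬ (Σ (Fin k) λ i → Σ (Fin k) λ j →
    ¬ (i ≡ j) × SameResidueRep n (InducedCycle.vert C i) (InducedCycle.vert C j))
proposition2p4 n _ k 4<k C (i , j , i≢j , i≈j) = >⇒∤ 4<k k∣4
  where
  open ≡-Reasoning
  next⁴-i≡i : next (next (next (next i))) ≡ i
  next⁴-i≡i = trans (cong (λ l → next (next l)) (sameResidueRep⇒next-next C i≢j i≈j))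
                    (sameResidueRep⇒next-next C (i≢j ∘ sym) (sameResidueRep-sym i≈j))
  k∣4 : k ∣ 4
  k∣4 = [m+o]%n≡m⇒n∣o (toℕ i) 4 k (begin
    (toℕ i + 4) % k                     ≡⟨ cong (_% k) (+-assoc (toℕ i) 2 2) ⟨
    (toℕ i + 2 + 2) % k                 ≡⟨ [m%n+o]%n≡[m+o]%n (toℕ i + 2) 2 k ⟨
    ((toℕ i + 2) % k + 2) % k           ≡⟨ cong (λ r → (r + 2) % k) (toℕ-next-next i) ⟨
    (toℕ (next (next i)) + 2) % k       ≡⟨ toℕ-next-next (next (next i)) ⟨
    toℕ (next (next (next (next i))))   ≡⟨ cong toℕ next⁴-i≡i ⟩
    toℕ i                               ∎)
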